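{- For any $\varepsilon\in\{+,-\}^n$, any $I_\bullet\subseteq\{0_\bullet,\dots,n_\bullet\}$ and any $J_\circ\subseteq\{1_\circ,\dots,(n+1)_\circ\}$ (with $\min(I_\bullet)<\min(J_\circ)$ and $\max(I_\bullet)<\max(J_\circ)$), the triangulation $\{\Delta_T : T\text{ an }(\varepsilon,I_\bullet,J_\circ)\text{ -tree}\}$ of $U_{I_\bullet,J_\circ}$ is regular.
   Context: Fix an integer $n\ge1$. Black vertices are $0_\bullet,\dots,n_\bullet$, white vertices $1_\circ,\dots,(n+1)_\circ$, compared through their integer indices. Given $\varepsilon\in\{+,-\}^n$, let $P_\varepsilon$ be a convex $(2n+2)$-gon in $\mathbb{R}^2$ whose vertices, in strictly increasing $x$-order, are $0_\bullet,1_\circ,1_\bullet,\dots,n_\circ,n_\bullet,(n+1)_\circ$, with $k_\circ,k_\bullet$ strictly above the line through $0_\bullet$ and $(n+1)_\circ$ if $\varepsilon_k=+$ and strictly below if $\varepsilon_k=-$ ($1\le k\le n$). For nonempty $I_\bullet,J_\circ$ as in the claim, let $G$ be the geometric graph on $I_\bullet\cup J_\circ$ with a straight edge $(i_\bullet,j_\circ)$ for each $i_\bullet\in I_\bullet,j_\circ\in J_\circ$ with $i<j$; two edges cross if they meet at a point interior to both. An $(\varepsilon,I_\bullet,J_\circ)$-tree is an inclusion-maximal set of pairwise non-crossing edges of $G$. Let $U_{I_\bullet,J_\circ}=\mathrm{conv}\{(\mathbf{e}_{i_\bullet},\mathbf{e}_{j_\circ}): i_\bullet\in I_\bullet, j_\circ\in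 J_\circ, i<j\}\subseteq\mathbb{R}^{I_\bullet}\times\mathbb{R}^{J_\circ}$ (standard basis vectors) and $\Delta_T=\mathrm{conv}\{(\mathbf{e}_{i_\bullet},\mathbf{e}_{j_\circ}): (i_\bullet,j_\circ)\in T\}$; the simplices $\Delta_T$ form a triangulation of $U_{I_\bullet,J_\circ}$. A triangulation of a point configuration $P$ is regular if there is a function $h:P\to\mathbb{R}$ such that the triangulation is the projection of the lower faces of $\mathrm{conv}\{(p,h(p)):p\in P\}$.
   Formalization: The polygon $P_\varepsilon$ has vertices with rational coordinates rather than arbitrary points of $\mathbb{R}^2$, and the heights h are taken in the rationals. -}

module Defs where

open import Data.Nat as ℕ using (ℕ; zero; suc; _∸_) renaming (_<_ to _<ℕ_; _≤_ to _≤ℕ_; _*_ to _*ℕ_; _+_ to _+ℕ_)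
open import Data.Fin using (Fin; toℕ)
open import Data.Fin.Subset using (Subset; _∈_; Nonempty)
open import Data.Rational using (ℚ; 0ℚ; 1ℚ; _+_; _*_; _-_; _<_)
open import Data.Product using (_×_; _,_; proj₁; proj₂; Σ; ∃; ∃-syntax)
open import Data.Bool using (Bool; true; false)
open import Relation.Binary.PropositionalEquality using (_≡_; _≢_)
open import Relation.Nullary using (¬_)

data Sign : Set where
  plus minus : Sign

Point : Set
Point = ℚ × ℚ

-- orientation determinant of (p, q, r): positive iff r is strictly to the
-- left of the directed line p → q
orient : Point → Point → Point → ℚ
orient (px , py) (qx , qy) (rx , ry) = ((qx - px) * (ry - py)) - ((qy - py) * (rx - px))

-- A polygon is given by  pt : ℕ → Point,  where position p ∈ {0,…,2n+1}
-- is the p-th vertex in increasing x-order: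
--   position 2k     = k_•   (k = 0..n)
--   position 2k - 1 = k_∘   (k = 1..n+1)
-- (values of pt at positions > 2n+1 are irrelevant).

-- Black vertex b : Fin (suc n) is  (toℕ b)_• ; white vertex w : Fin (suc n)
-- is  (toℕ w + 1)_∘ .
blackPt : (ℕ → Point) → {n : ℕ} → Fin (suc n) → Point
blackPt pt b = pt (2 *ℕ toℕ b)

whitePt : (ℕ → Point) → {n : ℕ} → Fin (suc n) → Point
whitePt pt w = pt (suc (2 *ℕ toℕ w))

-- strictly above / below the line through 0_• and (n+1)_∘
OnSide : Sign → Point → Point → Point → Set
OnSide plus  a b p = 0ℚ < orient a b p
OnSide minus a b p = orient a b p < 0ℚ

record IsPolygon (n : ℕ) (ε : Fin n → Sign) (pt : ℕ → Point) : Set where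
  field
    x-increasing : ∀ p q → p <ℕ q → q ≤ℕ suc (2 *ℕ n) → proj₁ (pt p) < proj₁ (pt q)
    -- k_∘ and k_• (k = toℕ k' + 1) above the line if ε_k = +, below if −
    sides : ∀ (k : Fin n) →
      OnSide (ε k) (pt 0) (pt (suc (2 *ℕ n))) (pt (suc (2 *ℕ toℕ k)))
      × OnSide (ε k) (pt 0) (pt (suc (2 *ℕ n))) (pt (2 *ℕ suc (toℕ k)))
    -- convex position: every point is a vertex of the convex hull, i.e.
    -- some linear functional is uniquely maximised there
    vertices : ∀ p → p ≤ℕ suc (2 *ℕ n) →
      Σ ℚ λ a → Σ ℚ λ c → (∀ q → q ≤ℕ suc (2 *ℕ n) → q ≢ p →
        ((a * proj₁ (pt q)) + (c * proj₂ (pt q))) < ((a * proj₁ (pt p)) + (c * proj₂ (pt p))))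

Crosses : Point → Point → Point → Point → Set
Crosses (px , py) (qx , qy) (rx , ry) (sx , sy) =
  Σ ℚ λ t → Σ ℚ λ u → (0ℚ < t × t < 1ℚ × 0ℚ < u × u < 1ℚ
    × (px + (t * (qx - px))) ≡ (rx + (u * (sx - rx)))
    × (py + (t * (qy - py))) ≡ (ry + (u * (sy - ry))))

-- Vertex subsets and the conditions min I < min J, max I < max J.
-- I : Subset (suc n) — b ∈ I means (toℕ b)_• ∈ I_•
-- J : Subset (suc n) — w ∈ J means (toℕ w + 1)_∘ ∈ J_∘

IsMinB : {n : ℕ} → Subset (suc n) → Fin (suc n) → Set
IsMinB I b = b ∈ I × (∀ b' → b' ∈ I → toℕ b ≤ℕ toℕ b')

IsMaxB : {n : ℕ} → Subset (suc n) → Fin (suc n) → Set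
IsMaxB I b = b ∈ I × (∀ b' → b' ∈ I → toℕ b' ≤ℕ toℕ b)

IsMinW : {n : ℕ} → Subset (suc n) → Fin (suc n) → Set
IsMinW J w = w ∈ J × (∀ w' → w' ∈ J → toℕ w ≤ℕ toℕ w')

IsMaxW : {n : ℕ} → Subset (suc n) → Fin (suc n) → Set
IsMaxW J w = w ∈ J × (∀ w' → w' ∈ J → toℕ w' ≤ℕ toℕ w)

-- min(I_•) < min(J_∘)  (white w has integer index toℕ w + 1)
MinLt : {n : ℕ} → Subset (suc n) → Subset (suc n) → Set
MinLt I J = ∀ b w → IsMinB I b → IsMinW J w → toℕ b <ℕ suc (toℕ w)

MaxLt : {n : ℕ} → Subset (suc n) → Subset (suc n) → Set
MaxLt I J = ∀ b w → IsMaxB I b → IsMaxW J w → toℕ b <ℕ suc (toℕ w)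

-- (b_•, w_∘) is an edge of G  (i < j with j = toℕ w + 1)
Edge : {n : ℕ} → Subset (suc n) → Subset (suc n) → Fin (suc n) → Fin (suc n) → Set
Edge I J b w = b ∈ I × w ∈ J × toℕ b <ℕ suc (toℕ w)

EdgeSet : ℕ → Set
EdgeSet n = Fin (suc n) → Fin (suc n) → Bool

InG : {n : ℕ} → Subset (suc n) → Subset (suc n) → EdgeSet n → Set
InG I J T = ∀ b w → T b w ≡ true → Edge I J b w

NonCrossing : (ℕ → Point) → {n : ℕ} → EdgeSet n → Set
NonCrossing pt T = ∀ b w b' w' → T b w ≡ true → T b' w' ≡ true →
  (b , w) ≢ (b' , w') →
  ¬ Crosses (blackPt pt b) (whitePt pt w) (blackPt pt b') (whitePt pt w')

IsTree : (ℕ → Point) → {n : ℕ} → Subset (suc n) → Subset (suc n) → EdgeSet n → Set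
IsTree pt {n} I J T =
  InG I J T × NonCrossing pt T ×
  (∀ (T' : EdgeSet n) → InG I J T' → NonCrossing pt T' →
     (∀ b w → T b w ≡ true → T' b w ≡ true) →
     (∀ b w → T' b w ≡ true → T b w ≡ true))

-- The points of U are (e_b, e_w) for edges (b,w) of G. A height function
-- h assigns a rational to each such point. Δ_T is the projection of a
-- lower face of the lifted configuration iff there is an affine function
-- on ℝ^I × ℝ^J, whose value at (e_b, e_w) is α b + β w (the constant term
-- is absorbed into α), agreeing with h on the vertices of Δ_T and strictly
-- below h on all other points of U.

IsRegularTreeTriangulation : (ℕ → Point) → {n : ℕ} → Subset (suc n) → Subset (suc n) → Set
IsRegularTreeTriangulation pt {n} I J =
  Σ (Fin (suc n) → Fin (suc n) → ℚ) λ h → (∀ (T : EdgeSet n) → IsTree pt I J T →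
    Σ (Fin (suc n) → ℚ) λ α → Σ (Fin (suc n) → ℚ) λ β → (∀ b w → Edge I J b w →
      (T b w ≡ true → (α b + β w) ≡ h b w)
      × (T b w ≡ false → (α b + β w) < h b w)))

-- Take the heights h(i_•, k_∘) = x_i z_k with x_i = ε_i i and z_k = −ε_k (n + 1 − k).
-- Multiplying all x and z by ε_m, for m the rightmost black vertex of I, leaves h unchanged
-- and makes x_i < x_m for every i < m. In these coordinates convexity of P_ε says that, for
-- i < m, the edges (i_•, v_∘) and (m_•, w_∘) cross exactly when m < v and z_v < z_w.
-- So in a tree T only the neighbour c of m with the largest z can have further edges; the
-- other neighbours of m are leaves. Deleting m and these leaves gives a tree on smaller
-- vertex sets, and an affine function α ⊕ β supporting its simplex extends to one for T:
-- α(m) is tight at (m, c) and β at each leaf is tight at (m, leaf). Every other edge of G stays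
-- strictly below h because x z′ + x′ z < x z + x′ z′ whenever x < x′ and z < z′.

module Submission where

module TreeTriangulations where

  open import Defs

  open import Data.Bool using (true; false; if_then_else_)
  import Data.Bool.Properties as Bool
  open import Data.Empty using (⊥; ⊥-elim)
  open import Data.Fin using (Fin; zero; suc; toℕ; fromℕ<)
  import Data.Fin.Properties as Fin
  open import Data.Fin.Subset using (Subset; _∈_; Nonempty)
  open import Data.Fin.Subset.Properties using (_∈?_)
  open import Data.Nat using (ℕ; zero; suc; z≤n; s≤s; _∸_)
    renaming (_<_ to _<ℕ_; _≤_ to _≤ℕ_; _*_ to _*ℕ_)
  import Data.Nat.Properties as ℕ
  open import Data.Product using (_×_; _,_; proj₁; proj₂; Σ; ∃; ∃-syntax; ∃₂)
  open import Data.Rational using (ℚ; 0ℚ; 1ℚ; _+_; _*_; _-_; -_; _<_; _≤_; 1/_; NonZero; Positive; positive; negative; nonNegative)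
  open import Data.Rational.Properties
  open import Data.Rational.Solver using (module +-*-Solver)
  open import Data.Sum using (_⊎_; inj₁; inj₂)
  open import Data.Vec using (tabulate)
  open import Data.Vec.Properties using (lookup∘tabulate; []=⇒lookup; lookup⇒[]=)
  open import Function.Base using (_∘_)
  open import Function.Bundles using (_⇔_; mk⇔; Equivalence)
  open import Function.Construct.Composition using (_⇔-∘_)
  open import Level using (Level)
  open import Relation.Binary.Bundles using (TotalPreorder)
  import Relation.Binary.Construct.Flip.EqAndOrd as Flip
  open import Relation.Binary.Definitions using (tri<; tri≈; tri>)
  open import Relation.Binary.PropositionalEquality
  open import Relation.Nullary using (¬_; Dec; yes; no; does)
  open import Relation.Nullary.Decidable using (_×-dec_; _⊎-dec_; ¬?; dec-true; dec-false; decidable-stable)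
  open import Relation.Unary using (Pred; Decidable)

  open +-*-Solver using (solve; _:+_; _:*_; _:-_; :-_; _:=_; con)

  0<p-q : ∀ {p q} → q < p → 0ℚ < p - q
  0<p-q {p} {q} q<p = subst (_< p - q) (+-inverseʳ q) (+-monoˡ-< (- q) q<p)

  0<p+q : ∀ {p q} → 0ℚ < p → 0ℚ < q → 0ℚ < p + q
  0<p+q p>0 q>0 = +-mono-< p>0 q>0

  0<p*q : ∀ {p q} → 0ℚ < p → 0ℚ < q → 0ℚ < p * q
  0<p*q {p} {q} p>0 q>0 = positive⁻¹ (p * q) {{pos*pos⇒pos p {{positive p>0}} q {{positive q>0}}}}

  0≤p*q : ∀ {p q} → 0ℚ ≤ p → 0ℚ ≤ q → 0ℚ ≤ p * q
  0≤p*q {p} {q} p≥0 q≥0 = nonNegative⁻¹ (p * q) {{nonNeg*nonNeg⇒nonNeg p {{nonNegative p≥0}} q {{nonNegative q≥0}}}}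

  0<p/q<1 : ∀ {p} q .{{_ : NonZero q}} → 0ℚ < q → 0ℚ < p → p < q → 0ℚ < p * 1/ q × p * 1/ q < 1ℚ
  0<p/q<1 {p} q q>0 p>0 p<q =
    0<p*q p>0 (positive⁻¹ (1/ q) {{1/q>0}}) ,
    subst (p * 1/ q <_) (*-inverseʳ q) (*-monoˡ-<-pos (1/ q) {{1/q>0}} p<q)
    where
    1/q>0 : Positive (1/ q)
    1/q>0 = 1/pos⇒pos q {{positive q>0}}

  ≤∧≢⇒< : ∀ {p q} → p ≤ q → p ≢ q → p < q
  ≤∧≢⇒< p≤q p≢q = ≰⇒> (λ q≤p → p≢q (≤-antisym p≤q q≤p))

  interior-between : ∀ {p q t} → 0ℚ < t → t < 1ℚ → p < q → p < p + t * (q - p) × p + t * (q - p) < q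
  interior-between {p} {q} {t} t>0 t<1 p<q =
    subst (_< p + t * (q - p)) (+-identityʳ p) (+-monoʳ-< p (0<p*q t>0 (0<p-q p<q))) ,
    subst (p + t * (q - p) <_) (solve 2 (λ p q → p :+ (q :- p) := q) refl p q)
      (+-monoʳ-< p (subst (t * (q - p) <_) (*-identityˡ (q - p))
        (*-monoˡ-<-pos (q - p) {{positive (0<p-q p<q)}} t<1)))

  cancel-invertible : ∀ {d w x y} → d * w ≡ 1ℚ → d * x ≡ d * y → x ≡ y
  cancel-invertible {d} {w} {x} {y} dw≡1 dx≡dy = begin
    x               ≡⟨ sym (*-identityˡ x) ⟩
    1ℚ * x          ≡⟨ cong (_* x) (trans (sym dw≡1) (*-comm d w)) ⟩
    (w * d) * x     ≡⟨ *-assoc w d x ⟩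
    w * (d * x)     ≡⟨ cong (w *_) dx≡dy ⟩
    w * (d * y)     ≡⟨ *-assoc w d y ⟨
    (w * d) * y     ≡⟨ cong (_* y) (trans (*-comm w d) dw≡1) ⟩
    1ℚ * y          ≡⟨ *-identityˡ y ⟩
    y               ∎
    where open ≡-Reasoning

  divide-affine : ∀ d .{{_ : NonZero d}} p q r s a b → d * p + a * (q - p) ≡ d * r + b * (s - r) →
    p + (a * 1/ d) * (q - p) ≡ r + (b * 1/ d) * (s - r)
  divide-affine d p q r s a b e =
    cancel-invertible {d} {1/ d} (*-inverseʳ d) (trans (scaled p q a) (trans e (sym (scaled r s b))))
    where
    scaled : ∀ p q c → d * (p + (c * 1/ d) * (q - p)) ≡ d * p + c * (q - p)
    scaled p q c = begin
      d * (p + (c * 1/ d) * (q - p))     ≡⟨ solve 5 (λ d w p q c → d :* (p :+ (c :* w) :* (q :- p))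
                                              := d :* p :+ c :* (q :- p) :* (d :* w)) refl d (1/ d) p q c ⟩
      d * p + c * (q - p) * (d * 1/ d)   ≡⟨ cong (λ e → d * p + c * (q - p) * e) (*-inverseʳ d) ⟩
      d * p + c * (q - p) * 1ℚ           ≡⟨ cong (d * p +_) (*-identityʳ _) ⟩
      d * p + c * (q - p)                ∎
      where open ≡-Reasoning

  product-exchange : ∀ {x x′ z z′} → x < x′ → z < z′ → x′ * z + x * z′ < x * z + x′ * z′
  product-exchange {x} {x′} {z} {z′} x<x′ z<z′ = begin-strict
    x′ * z + x * z′                           ≡⟨ +-identityʳ _ ⟨
    (x′ * z + x * z′) + 0ℚ                    <⟨ +-monoʳ-< (x′ * z + x * z′) (0<p*q (0<p-q x<x′) (0<p-q z<z′)) ⟩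
    (x′ * z + x * z′) + (x′ - x) * (z′ - z)   ≡⟨ solve 4 (λ x x′ z z′ →
                                                   (x′ :* z :+ x :* z′) :+ (x′ :- x) :* (z′ :- z) := x :* z :+ x′ :* z′)
                                                   refl x x′ z z′ ⟩
    x * z + x′ * z′                           ∎
    where open ≤-Reasoning

  new-row-strictly-below : ∀ {a b b′ x x′ z z′} → a + b ≡ x * z → a + b′ ≤ x * z′ → x < x′ → z < z′ →
    (x′ * z - b) + b′ < x′ * z′
  new-row-strictly-below {a} {b} {b′} {x} {x′} {z} {z′} tight below x<x′ z<z′ = begin-strict
    (x′ * z - b) + b′               ≡⟨ solve 4 (λ a b b′ t → (t :- b) :+ b′ := (t :- (a :+ b)) :+ (a :+ b′))
                                         refl a b b′ (x′ * z) ⟩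
    (x′ * z - (a + b)) + (a + b′)   ≡⟨ cong (λ t → (x′ * z - t) + (a + b′)) tight ⟩
    (x′ * z - x * z) + (a + b′)     ≤⟨ +-monoʳ-≤ (x′ * z - x * z) below ⟩
    (x′ * z - x * z) + x * z′       ≡⟨ solve 3 (λ p q r → (p :- q) :+ r := (p :+ r) :- q)
                                         refl (x′ * z) (x * z) (x * z′) ⟩
    (x′ * z + x * z′) - x * z       <⟨ +-monoˡ-< (- (x * z)) (product-exchange x<x′ z<z′) ⟩
    (x * z + x′ * z′) - x * z       ≡⟨ solve 2 (λ p q → (p :+ q) :- p := q) refl (x * z) (x′ * z′) ⟩
    x′ * z′                         ∎
    where open ≤-Reasoning

  new-column-strictly-below : ∀ {a b x x′ z z′} → a + b ≤ x * z → x < x′ → z′ < z →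
    a + (x′ * z′ - (x′ * z - b)) < x * z′
  new-column-strictly-below {a} {b} {x} {x′} {z} {z′} below x<x′ z′<z = begin-strict
    a + (x′ * z′ - (x′ * z - b))    ≡⟨ solve 4 (λ a b p q → a :+ (p :- (q :- b)) := (a :+ b) :+ (p :- q))
                                         refl a b (x′ * z′) (x′ * z) ⟩
    (a + b) + (x′ * z′ - x′ * z)    ≤⟨ +-monoˡ-≤ (x′ * z′ - x′ * z) below ⟩
    x * z + (x′ * z′ - x′ * z)      ≡⟨ solve 3 (λ p q r → p :+ (q :- r) := (q :+ p) :- r)
                                         refl (x * z) (x′ * z′) (x′ * z) ⟩
    (x′ * z′ + x * z) - x′ * z      <⟨ +-monoˡ-< (- (x′ * z)) (product-exchange x<x′ z′<z) ⟩
    (x * z′ + x′ * z) - x′ * z      ≡⟨ solve 2 (λ p q → (p :+ q) :- q := p) refl (x * z′) (x′ * z) ⟩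
    x * z′                          ∎
    where open ≤-Reasoning

  opposite : Sign → Sign
  opposite plus  = minus
  opposite minus = plus

  _⊙_ : Sign → Sign → Sign
  plus  ⊙ s = s
  minus ⊙ s = opposite s

  signed : Sign → ℚ → ℚ
  signed plus  q = q
  signed minus q = - q

  signed-opposite : ∀ s q → signed (opposite s) q ≡ - signed s q
  signed-opposite plus  q = refl
  signed-opposite minus q = solve 1 (λ q → q := :- (:- q)) refl q

  signed-⊙-* : ∀ σ s t p q → signed (σ ⊙ s) p * signed (σ ⊙ t) q ≡ signed s p * signed t q
  signed-⊙-* plus  s t p q = refl
  signed-⊙-* minus s t p q = begin
    signed (opposite s) p * signed (opposite t) q ≡⟨ cong₂ _*_ (signed-opposite s p) (signed-opposite t q) ⟩
    - signed s p * - signed t q                   ≡⟨ solve 2 (λ x y → (:- x) :* (:- y) := x :* y)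
                                                       refl (signed s p) (signed t q) ⟩
    signed s p * signed t q                       ∎
    where open ≡-Reasoning

  ⊙-self : ∀ s → s ⊙ s ≡ plus
  ⊙-self plus  = refl
  ⊙-self minus = refl

  ⊙-opposite≡minus⇔≡ : ∀ s t → s ⊙ opposite t ≡ minus ⇔ s ≡ t
  ⊙-opposite≡minus⇔≡ plus  plus  = mk⇔ (λ _ → refl) (λ _ → refl)
  ⊙-opposite≡minus⇔≡ plus  minus = mk⇔ (λ ()) (λ ())
  ⊙-opposite≡minus⇔≡ minus plus  = mk⇔ (λ ()) (λ ())
  ⊙-opposite≡minus⇔≡ minus minus = mk⇔ (λ _ → refl) (λ _ → refl)

  ⊙-opposite≡plus⇔≢ : ∀ s t → s ⊙ opposite t ≡ plus ⇔ s ≢ t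
  ⊙-opposite≡plus⇔≢ plus  plus  = mk⇔ (λ ()) (λ s≢t → ⊥-elim (s≢t refl))
  ⊙-opposite≡plus⇔≢ plus  minus = mk⇔ (λ _ ()) (λ _ → refl)
  ⊙-opposite≡plus⇔≢ minus plus  = mk⇔ (λ _ ()) (λ _ → refl)
  ⊙-opposite≡plus⇔≢ minus minus = mk⇔ (λ ()) (λ s≢t → ⊥-elim (s≢t refl))

  toℚ : ℕ → ℚ
  toℚ zero    = 0ℚ
  toℚ (suc k) = 1ℚ + toℚ k

  toℚ-<-suc : ∀ k → toℚ k < toℚ (suc k)
  toℚ-<-suc k = subst (_< 1ℚ + toℚ k) (+-identityˡ (toℚ k)) (+-monoˡ-< (toℚ k) (positive⁻¹ 1ℚ))

  0≤toℚ : ∀ k → 0ℚ ≤ toℚ k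
  0≤toℚ zero    = ≤-refl
  0≤toℚ (suc k) = <⇒≤ (≤-<-trans (0≤toℚ k) (toℚ-<-suc k))

  toℚ-mono-< : ∀ {i m} → i <ℕ m → toℚ i < toℚ m
  toℚ-mono-< {i} {suc m} (s≤s i≤m) with ℕ.m≤n⇒m<n∨m≡n i≤m
  ... | inj₁ i<m  = <-trans (toℚ-mono-< i<m) (toℚ-<-suc m)
  ... | inj₂ refl = toℚ-<-suc m

  signed<toℚ : ∀ s {i m} → i <ℕ m → signed s (toℚ i) < toℚ m
  signed<toℚ plus  i<m = toℚ-mono-< i<m
  signed<toℚ minus {i} i<m = ≤-<-trans (neg-antimono-≤ (0≤toℚ i)) (≤-<-trans (0≤toℚ i) (toℚ-mono-< i<m))

  -toℚ<signed : ∀ s {i m} → i <ℕ m → - toℚ m < signed s (toℚ i)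
  -toℚ<signed plus  {i} i<m = <-≤-trans (neg-antimono-< (≤-<-trans (0≤toℚ i) (toℚ-mono-< i<m))) (0≤toℚ i)
  -toℚ<signed minus i<m = neg-antimono-< (toℚ-mono-< i<m)

  module _ {p q} (q<p : q <ℕ p) where

    dominant-<⇔minus : ∀ s t → signed s (toℚ p) < signed t (toℚ q) ⇔ s ≡ minus
    dominant-<⇔minus plus  t = mk⇔ (λ p<x → ⊥-elim (<-asym p<x (signed<toℚ t q<p))) (λ ())
    dominant-<⇔minus minus t = mk⇔ (λ _ → refl) (λ _ → -toℚ<signed t q<p)

    dominant->⇔plus : ∀ s t → signed t (toℚ q) < signed s (toℚ p) ⇔ s ≡ plus
    dominant->⇔plus plus  t = mk⇔ (λ _ → refl) (λ _ → signed<toℚ t q<p)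
    dominant->⇔plus minus t = mk⇔ (λ x<-p → ⊥-elim (<-asym x<-p (-toℚ<signed t q<p))) (λ ())

    dominant-≢ : ∀ s t → signed s (toℚ p) ≢ signed t (toℚ q)
    dominant-≢ plus  t e = <-irrefl (sym e) (signed<toℚ t q<p)
    dominant-≢ minus t e = <-irrefl e (-toℚ<signed t q<p)

  -- Orientation and crossing of segments

  orient-swap : ∀ A B C → orient A C B ≡ - orient A B C
  orient-swap (ax , ay) (bx , by) (cx , cy) = solve 6 (λ ax ay bx by cx cy →
    ((cx :- ax) :* (by :- ay)) :- ((cy :- ay) :* (bx :- ax))
    := :- (((bx :- ax) :* (cy :- ay)) :- ((by :- ay) :* (cx :- ax)))) refl ax ay bx by cx cy

  orient-rotate : ∀ A B C → orient B C A ≡ orient A B C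
  orient-rotate (ax , ay) (bx , by) (cx , cy) = solve 6 (λ ax ay bx by cx cy →
    ((cx :- bx) :* (ay :- by)) :- ((cy :- by) :* (ax :- bx))
    := ((bx :- ax) :* (cy :- ay)) :- ((by :- ay) :* (cx :- ax))) refl ax ay bx by cx cy

  orient-reverse : ∀ A B C → orient B A C ≡ - orient A B C
  orient-reverse A B C = trans (orient-rotate C B A) (trans (orient-rotate A C B) (orient-swap A B C))

  orient-firstEnd : ∀ A B → orient A B A ≡ 0ℚ
  orient-firstEnd (ax , ay) (bx , by) = solve 4 (λ ax ay bx by →
    ((bx :- ax) :* (ay :- ay)) :- ((by :- ay) :* (ax :- ax)) := con 0ℚ) refl ax ay bx by

  orient-secondEnd : ∀ A B → orient A B B ≡ 0ℚ
  orient-secondEnd (ax , ay) (bx , by) = solve 4 (λ ax ay bx by →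
    ((bx :- ax) :* (by :- ay)) :- ((by :- ay) :* (bx :- ax)) := con 0ℚ) refl ax ay bx by

  onSide-negate : ∀ s A B C D E F → orient D E F ≡ - orient A B C →
    OnSide s A B C → OnSide (opposite s) D E F
  onSide-negate plus  A B C _ _ _ e h = subst (_< 0ℚ) (sym e) (neg-antimono-< {0ℚ} {orient A B C} h)
  onSide-negate minus A B C _ _ _ e h = subst (0ℚ <_) (sym e) (neg-antimono-< {orient A B C} {0ℚ} h)

  onSide-swap : ∀ s A B C → OnSide s A B C → OnSide (opposite s) A C B
  onSide-swap s A B C = onSide-negate s A B C A C B (orient-swap A B C)

  onSide-reverse : ∀ s A B C → OnSide s A B C → OnSide (opposite s) B A C
  onSide-reverse s A B C = onSide-negate s A B C B A C (orient-reverse A B C)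

  onSide-rotate : ∀ s A B C → OnSide s A B C → OnSide s B C A
  onSide-rotate plus  A B C = subst (0ℚ <_) (sym (orient-rotate A B C))
  onSide-rotate minus A B C = subst (_< 0ℚ) (sym (orient-rotate A B C))

  linear : ℚ → ℚ → Point → ℚ
  linear α γ P = α * proj₁ P + γ * proj₂ P

  maximum-above-chord : ∀ α γ A B C → proj₁ A < proj₁ B → proj₁ B < proj₁ C →
    linear α γ A < linear α γ B → linear α γ C < linear α γ B → 0ℚ < γ * orient A C B
  maximum-above-chord α γ A@(ax , ay) B@(bx , by) C@(cx , cy) A<B B<C LA<LB LC<LB =
    subst (0ℚ <_) (sym decomposition) (0<p+q (0<p*q (0<p-q B<C) (0<p-q LA<LB)) (0<p*q (0<p-q A<B) (0<p-q LC<LB)))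
    where
    decomposition : γ * orient A C B ≡
      (cx - bx) * (linear α γ B - linear α γ A) + (bx - ax) * (linear α γ B - linear α γ C)
    decomposition = solve 8 (λ ax ay bx by cx cy α γ →
      γ :* (((cx :- ax) :* (by :- ay)) :- ((cy :- ay) :* (bx :- ax)))
      := (cx :- bx) :* ((α :* bx :+ γ :* by) :- (α :* ax :+ γ :* ay))
         :+ (bx :- ax) :* ((α :* bx :+ γ :* by) :- (α :* cx :+ γ :* cy))) refl ax ay bx by cx cy α γ

  onSide-transfer : ∀ s γ A B C D E F → 0ℚ < γ * orient A B C → 0ℚ < γ * orient D E F →
    OnSide s A B C → OnSide s D E F
  onSide-transfer plus γ A B C D E F γx>0 γy>0 x>0 =
    *-cancelˡ-<-nonNeg γ {{pos⇒nonNeg γ {{positive γ>0}}}} (subst (_< γ * orient D E F) (sym (*-zeroʳ γ)) γy>0)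
    where
    γ>0 : 0ℚ < γ
    γ>0 = *-cancelʳ-<-nonNeg (orient A B C) {{pos⇒nonNeg (orient A B C) {{positive {orient A B C} x>0}}}}
            (subst (_< γ * orient A B C) (sym (*-zeroˡ (orient A B C))) γx>0)
  onSide-transfer minus γ A B C D E F γx>0 γy>0 x<0 =
    *-cancelˡ-<-nonPos γ {{neg⇒nonPos γ {{negative γ<0}}}} (subst (_< γ * orient D E F) (sym (*-zeroʳ γ)) γy>0)
    where
    γ<0 : γ < 0ℚ
    γ<0 = *-cancelʳ-<-nonPos (orient A B C) {{neg⇒nonPos (orient A B C) {{negative {orient A B C} x<0}}}}
            (subst (_< γ * orient A B C) (sym (*-zeroˡ (orient A B C))) γx>0)

  crosses-sym : ∀ P Q R S → Crosses P Q R S → Crosses R S P Q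
  crosses-sym _ _ _ _ (t , u , t>0 , t<1 , u>0 , u<1 , ex , ey) =
    u , t , u>0 , u<1 , t>0 , t<1 , sym ex , sym ey

  crosses-reverseʳ : ∀ P Q R S → Crosses P Q R S → Crosses P Q S R
  crosses-reverseʳ _ _ (rx , ry) (sx , sy) (t , u , t>0 , t<1 , u>0 , u<1 , ex , ey) =
    t , 1ℚ - u , t>0 , t<1 , 0<p-q u<1 , 1-u<1 , trans ex (reparam rx sx) , trans ey (reparam ry sy)
    where
    reparam : ∀ r s → r + u * (s - r) ≡ s + (1ℚ - u) * (r - s)
    reparam r s = solve 3 (λ r s u → r :+ u :* (s :- r) := s :+ (con 1ℚ :- u) :* (r :- s)) refl r s u
    1-u<1 : 1ℚ - u < 1ℚ
    1-u<1 = subst (1ℚ - u <_) (+-identityʳ 1ℚ) (+-monoʳ-< 1ℚ (neg-antimono-< u>0))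

  crosses-reverseˡ : ∀ P Q R S → Crosses P Q R S → Crosses Q P R S
  crosses-reverseˡ P Q R S c = crosses-sym R S Q P (crosses-reverseʳ R S P Q (crosses-sym P Q R S c))

  crossing-point-on-line : ∀ P Q R S → Crosses P Q R S →
    Σ ℚ λ u → 0ℚ < u × u < 1ℚ × (1ℚ - u) * orient P Q R + u * orient P Q S ≡ 0ℚ
  crossing-point-on-line P@(px , py) Q@(qx , qy) R@(rx , ry) S@(sx , sy) (t , u , _ , _ , u>0 , u<1 , ex , ey) =
    u , u>0 , u<1 , (begin
      (1ℚ - u) * orient P Q R + u * orient P Q S
        ≡⟨ affine ⟩
      orient P Q (rx + u * (sx - rx) , ry + u * (sy - ry))
        ≡⟨ cong₂ (λ x y → orient P Q (x , y)) (sym ex) (sym ey) ⟩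
      orient P Q (px + t * (qx - px) , py + t * (qy - py))
        ≡⟨ on-line ⟩
      0ℚ ∎)
    where
    open ≡-Reasoning
    affine : (1ℚ - u) * orient P Q R + u * orient P Q S ≡ orient P Q (rx + u * (sx - rx) , ry + u * (sy - ry))
    affine = solve 9 (λ px py qx qy rx ry sx sy u →
      (con 1ℚ :- u) :* (((qx :- px) :* (ry :- py)) :- ((qy :- py) :* (rx :- px)))
        :+ u :* (((qx :- px) :* (sy :- py)) :- ((qy :- py) :* (sx :- px)))
      := ((qx :- px) :* ((ry :+ u :* (sy :- ry)) :- py)) :- ((qy :- py) :* ((rx :+ u :* (sx :- rx)) :- px)))
      refl px py qx qy rx ry sx sy u
    on-line : orient P Q (px + t * (qx - px) , py + t * (qy - py)) ≡ 0ℚ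
    on-line = solve 5 (λ px py qx qy t →
      ((qx :- px) :* ((py :+ t :* (qy :- py)) :- py)) :- ((qy :- py) :* ((px :+ t :* (qx :- px)) :- px))
      := con 0ℚ) refl px py qx qy t

  ¬crosses-weaklySameSide : ∀ P Q R S → 0ℚ ≤ orient P Q R → 0ℚ < orient P Q S → ¬ Crosses P Q R S
  ¬crosses-weaklySameSide P Q R S R≥0 S>0 c = absurd (crossing-point-on-line P Q R S c)
    where
    absurd : (Σ ℚ λ u → 0ℚ < u × u < 1ℚ × (1ℚ - u) * orient P Q R + u * orient P Q S ≡ 0ℚ) → ⊥
    absurd (u , u>0 , u<1 , e) = <-irrefl (sym e) (+-mono-≤-< (0≤p*q (<⇒≤ (0<p-q u<1)) R≥0) (0<p*q u>0 S>0))

  ¬crosses-sameSide : ∀ s P Q R S → OnSide s P Q R → OnSide s P Q S → ¬ Crosses P Q R S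
  ¬crosses-sameSide plus  P Q R S R⁺ S⁺ = ¬crosses-weaklySameSide P Q R S (<⇒≤ R⁺) S⁺
  ¬crosses-sameSide minus P Q R S R⁻ S⁻ c = ¬crosses-weaklySameSide Q P R S
    (<⇒≤ (onSide-reverse minus P Q R R⁻)) (onSide-reverse minus P Q S S⁻) (crosses-reverseˡ P Q R S c)

  ¬crosses-onLine : ∀ s P Q R S → orient P Q R ≡ 0ℚ → OnSide s P Q S → ¬ Crosses P Q R S
  ¬crosses-onLine plus  P Q R S R⁰ S⁺ = ¬crosses-weaklySameSide P Q R S (≤-reflexive (sym R⁰)) S⁺
  ¬crosses-onLine minus P Q R S R⁰ S⁻ c = ¬crosses-weaklySameSide Q P R S
    (≤-reflexive (sym (trans (orient-reverse P Q R) (cong -_ R⁰)))) (onSide-reverse minus P Q S S⁻)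
    (crosses-reverseˡ P Q R S c)

  ¬crosses-sharingFirst : ∀ s P Q S → OnSide s P Q S → ¬ Crosses P Q P S
  ¬crosses-sharingFirst s P Q S = ¬crosses-onLine s P Q P S (orient-firstEnd P Q)

  ¬crosses-sharingSecond : ∀ s P Q R → OnSide s P Q R → ¬ Crosses P Q R Q
  ¬crosses-sharingSecond s P Q R R± c =
    ¬crosses-onLine s P Q Q R (orient-secondEnd P Q) R± (crosses-reverseʳ P Q R Q c)

  ¬crosses-separated : ∀ P Q R S → proj₁ P < proj₁ Q → proj₁ R < proj₁ S → proj₁ Q < proj₁ R →
    ¬ Crosses P Q R S
  ¬crosses-separated _ _ _ _ P<Q R<S Q<R (t , u , t>0 , t<1 , u>0 , u<1 , ex , _) =
    <-irrefl ex (<-trans (proj₂ (interior-between t>0 t<1 P<Q))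
                  (<-trans Q<R (proj₁ (interior-between u>0 u<1 R<S))))

  crosses-oppositeSides⁻ : ∀ P Q R S → orient P Q R < 0ℚ → 0ℚ < orient P Q S →
    orient R S Q < 0ℚ → 0ℚ < orient R S P → Crosses P Q R S
  crosses-oppositeSides⁻ P@(px , py) Q@(qx , qy) R@(rx , ry) S@(sx , sy) R⁻ S⁺ Q⁻ P⁺ =
    a * 1/ d , b * 1/ d , proj₁ t-bounds , proj₂ t-bounds , proj₁ u-bounds , proj₂ u-bounds ,
    divide-affine d px qx rx sx a b x-identity , divide-affine d py qy ry sy a b y-identity
    where
    a b d : ℚ
    a = orient R S P
    b = - orient P Q R
    d = orient R S P - orient R S Q
    d>0 : 0ℚ < d
    d>0 = 0<p-q (<-trans Q⁻ P⁺)
    instance _ = pos⇒nonZero d {{positive d>0}}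
    a<d : a < d
    a<d = subst (_< d) (+-identityʳ a) (+-monoʳ-< a (neg-antimono-< Q⁻))
    d≡ : d ≡ orient P Q S + b
    d≡ = solve 8 (λ px py qx qy rx ry sx sy →
      let oRSP = ((sx :- rx) :* (py :- ry)) :- ((sy :- ry) :* (px :- rx))
          oRSQ = ((sx :- rx) :* (qy :- ry)) :- ((sy :- ry) :* (qx :- rx))
          oPQS = ((qx :- px) :* (sy :- py)) :- ((qy :- py) :* (sx :- px))
          oPQR = ((qx :- px) :* (ry :- py)) :- ((qy :- py) :* (rx :- px))
      in oRSP :- oRSQ := oPQS :+ (:- oPQR)) refl px py qx qy rx ry sx sy
    b<d : b < d
    b<d = subst (b <_) (trans (+-comm b _) (sym d≡)) (subst (_< b + orient P Q S) (+-identityʳ b) (+-monoʳ-< b S⁺))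
    t-bounds : 0ℚ < a * 1/ d × a * 1/ d < 1ℚ
    t-bounds = 0<p/q<1 d d>0 P⁺ a<d
    u-bounds : 0ℚ < b * 1/ d × b * 1/ d < 1ℚ
    u-bounds = 0<p/q<1 d d>0 (neg-antimono-< R⁻) b<d
    x-identity : d * px + a * (qx - px) ≡ d * rx + b * (sx - rx)
    x-identity = solve 8 (λ px py qx qy rx ry sx sy →
      let a = ((sx :- rx) :* (py :- ry)) :- ((sy :- ry) :* (px :- rx))
          d = a :- (((sx :- rx) :* (qy :- ry)) :- ((sy :- ry) :* (qx :- rx)))
          b = :- (((qx :- px) :* (ry :- py)) :- ((qy :- py) :* (rx :- px)))
      in d :* px :+ a :* (qx :- px) := d :* rx :+ b :* (sx :- rx)) refl px py qx qy rx ry sx sy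
    y-identity : d * py + a * (qy - py) ≡ d * ry + b * (sy - ry)
    y-identity = solve 8 (λ px py qx qy rx ry sx sy →
      let a = ((sx :- rx) :* (py :- ry)) :- ((sy :- ry) :* (px :- rx))
          d = a :- (((sx :- rx) :* (qy :- ry)) :- ((sy :- ry) :* (qx :- rx)))
          b = :- (((qx :- px) :* (ry :- py)) :- ((qy :- py) :* (rx :- px)))
      in d :* py :+ a :* (qy :- py) := d :* ry :+ b :* (sy :- ry)) refl px py qx qy rx ry sx sy

  crosses-oppositeSides : ∀ s P Q R S → OnSide s P Q R → OnSide (opposite s) P Q S →
    OnSide s R S Q → OnSide (opposite s) R S P → Crosses P Q R S
  crosses-oppositeSides minus = crosses-oppositeSides⁻
  crosses-oppositeSides plus P Q R S R⁺ S⁻ Q⁺ P⁻ = crosses-reverseˡ Q P R S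
    (crosses-oppositeSides⁻ Q P R S (onSide-reverse plus P Q R R⁺) (onSide-reverse minus P Q S S⁻) P⁻ Q⁺)

  -- The polygon P_ε

  module ConvexPolygon {n ε pt} (polygon : IsPolygon n ε pt) where
    open IsPolygon polygon

    N : ℕ
    N = suc (2 *ℕ n)

    private
      x-< : ∀ {p q} → p <ℕ q → q ≤ℕ N → proj₁ (pt p) < proj₁ (pt q)
      x-< = x-increasing _ _

    chord-side : ∀ s {a b c} → a <ℕ b → b <ℕ c → c ≤ℕ N →
      OnSide s (pt 0) (pt N) (pt b) → OnSide s (pt a) (pt c) (pt b)
    chord-side s {a} {b} {c} a<b b<c c≤N with vertices b (ℕ.<⇒≤ (ℕ.<-≤-trans b<c c≤N))
    ... | α , γ , maximum = onSide-transfer s γ (pt 0) (pt N) (pt b) (pt a) (pt c) (pt b)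
      (maximum-above-chord α γ (pt 0) (pt b) (pt N) (x-< 0<b b≤N) (x-< b<N ℕ.≤-refl)
        (below z≤n (ℕ.<⇒≢ 0<b)) (below ℕ.≤-refl (ℕ.>⇒≢ b<N)))
      (maximum-above-chord α γ (pt a) (pt b) (pt c) (x-< a<b b≤N) (x-< b<c c≤N)
        (below (ℕ.<⇒≤ (ℕ.<-trans a<b b<N)) (ℕ.<⇒≢ a<b)) (below c≤N (ℕ.>⇒≢ b<c)))
      where
      b<N : b <ℕ N
      b<N = ℕ.<-≤-trans b<c c≤N
      b≤N : b ≤ℕ N
      b≤N = ℕ.<⇒≤ b<N
      0<b : 0 <ℕ b
      0<b = ℕ.≤-<-trans z≤n a<b
      below : ∀ {q} → q ≤ℕ N → q ≢ b → linear α γ (pt q) < linear α γ (pt b)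
      below = maximum _

    module _ {a b c d} (a<b : a <ℕ b) (b<c : b <ℕ c) (c<d : c <ℕ d) (d≤N : d ≤ℕ N) {sb sc}
             (b-side : OnSide sb (pt 0) (pt N) (pt b)) (c-side : OnSide sc (pt 0) (pt N) (pt c)) where

      private
        A B C D : Point
        A = pt a
        B = pt b
        C = pt c
        D = pt d
        c≤N : c ≤ℕ N
        c≤N = ℕ.<⇒≤ (ℕ.<-≤-trans c<d d≤N)
        ACB : OnSide sb (pt a) (pt c) (pt b)
        ACB = chord-side sb a<b b<c c≤N b-side
        ADC : OnSide sc (pt a) (pt d) (pt c)
        ADC = chord-side sc (ℕ.<-trans a<b b<c) c<d d≤N c-side
        ADB : OnSide sb (pt a) (pt d) (pt b)
        ADB = chord-side sb a<b (ℕ.<-trans b<c c<d) d≤N b-side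
        BDC : OnSide sc (pt b) (pt d) (pt c)
        BDC = chord-side sc b<c c<d d≤N c-side

      crosses-interleaved⇔sameSide : Crosses A C B D ⇔ sb ≡ sc
      crosses-interleaved⇔sameSide = mk⇔ to from
        where
        to : Crosses A C B D → sb ≡ sc
        to cr = split sb sc ACB (onSide-swap sc A D C ADC)
          where
          split : ∀ s t → OnSide s A C B → OnSide (opposite t) A C D → s ≡ t
          split plus  plus  _ _ = refl
          split minus minus _ _ = refl
          split plus  minus B⁺ D⁺ = ⊥-elim (¬crosses-sameSide plus A C B D B⁺ D⁺ cr)
          split minus plus  B⁻ D⁻ = ⊥-elim (¬crosses-sameSide minus A C B D B⁻ D⁻ cr)
        from : sb ≡ sc → Crosses A C B D
        from refl = crosses-oppositeSides sb A C B D ACB (onSide-swap sb A D C ADC) BDC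
          (onSide-swap sb B A D (onSide-rotate sb D B A (onSide-rotate sb A D B ADB)))

      crosses-nested⇔oppositeSides : Crosses A D B C ⇔ sb ≢ sc
      crosses-nested⇔oppositeSides = mk⇔ to from
        where
        to : Crosses A D B C → sb ≢ sc
        to cr refl = ¬crosses-sameSide sb A D B C ADB ADC cr
        from : sb ≢ sc → Crosses A D B C
        from sb≢sc = split sb sc sb≢sc ADB ADC BDC ACB
          where
          split : ∀ s t → s ≢ t → OnSide s A D B → OnSide t A D C → OnSide t B D C → OnSide s A C B → Crosses A D B C
          split plus  plus  s≢t _ _ _ _ = ⊥-elim (s≢t refl)
          split minus minus s≢t _ _ _ _ = ⊥-elim (s≢t refl)
          split plus  minus _ ADB ADC BDC ACB = crosses-oppositeSides plus A D B C ADB ADC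
            (onSide-swap minus B D C BDC) (onSide-rotate minus A B C (onSide-swap plus A C B ACB))
          split minus plus  _ ADB ADC BDC ACB = crosses-oppositeSides minus A D B C ADB ADC
            (onSide-swap plus B D C BDC) (onSide-rotate plus A B C (onSide-swap minus A C B ACB))

    -- ε_k in the paper's indexing (k_• = pt (2k), k_∘ = pt (2k - 1)); plus outside 1 ≤ k ≤ n
    sign : ℕ → Sign
    sign zero = plus
    sign (suc k) with k ℕ.<? n
    ... | yes k<n = ε (fromℕ< k<n)
    ... | no _    = plus

    black : ℕ → Point
    black i = pt (2 *ℕ i)

    white : ℕ → Point
    white j = pt (suc (2 *ℕ j))

    private
      side : ∀ {k} (k<n : k <ℕ n) → OnSide (sign (suc k)) (pt 0) (pt N) (pt (suc (2 *ℕ k)))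
                                    × OnSide (sign (suc k)) (pt 0) (pt N) (pt (2 *ℕ suc k))
      side {k} k<n with k ℕ.<? n
      ... | no k≮n = ⊥-elim (k≮n k<n)
      ... | yes k<n′ = subst (λ i → OnSide (ε (fromℕ< k<n′)) (pt 0) (pt N) (pt (suc (2 *ℕ i)))
                                    × OnSide (ε (fromℕ< k<n′)) (pt 0) (pt N) (pt (2 *ℕ suc i)))
                             (Fin.toℕ-fromℕ< k<n′) (sides (fromℕ< k<n′))

    black-side : ∀ {m} → 0 <ℕ m → m ≤ℕ n → OnSide (sign m) (pt 0) (pt N) (black m)
    black-side {suc k} _ m≤n = proj₂ (side m≤n)

    white-side : ∀ {j} → j <ℕ n → OnSide (sign (suc j)) (pt 0) (pt N) (white j)
    white-side j<n = proj₁ (side j<n)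

    private
      black<black : ∀ {i m} → i <ℕ m → 2 *ℕ i <ℕ 2 *ℕ m
      black<black = ℕ.*-monoʳ-< 2

      black<white : ∀ {m j} → m ≤ℕ j → 2 *ℕ m <ℕ suc (2 *ℕ j)
      black<white m≤j = s≤s (ℕ.*-monoʳ-≤ 2 m≤j)

      white<black : ∀ {j m} → j <ℕ m → suc (2 *ℕ j) <ℕ 2 *ℕ m
      white<black {j} {m} j<m = subst (_≤ℕ 2 *ℕ m) (ℕ.*-suc 2 j) (ℕ.*-monoʳ-≤ 2 j<m)

      white<white : ∀ {j l} → j <ℕ l → suc (2 *ℕ j) <ℕ suc (2 *ℕ l)
      white<white j<l = s≤s (ℕ.*-monoʳ-< 2 j<l)

      white≤N : ∀ {j} → j ≤ℕ n → suc (2 *ℕ j) ≤ℕ N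
      white≤N j≤n = s≤s (ℕ.*-monoʳ-≤ 2 j≤n)

    ¬crosses-separatedEdges : ∀ {i j m l} → i ≤ℕ j → j <ℕ m → m ≤ℕ l → l ≤ℕ n →
      ¬ Crosses (black i) (white j) (black m) (white l)
    ¬crosses-separatedEdges {i} {j} {m} {l} i≤j j<m m≤l l≤n =
      ¬crosses-separated (black i) (white j) (black m) (white l)
        (x-< (black<white i≤j) (ℕ.<⇒≤ (ℕ.<-≤-trans (white<black j<m) m≤N)))
        (x-< (black<white m≤l) (white≤N l≤n))
        (x-< (white<black j<m) m≤N)
      where
      m≤N : 2 *ℕ m ≤ℕ N
      m≤N = ℕ.<⇒≤ (ℕ.<-≤-trans (black<white m≤l) (white≤N l≤n))

    crosses⇔sameSign : ∀ {i j m l} → i <ℕ m → m ≤ℕ j → j <ℕ l → l ≤ℕ n →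
      Crosses (black i) (white j) (black m) (white l) ⇔ sign m ≡ sign (suc j)
    crosses⇔sameSign {j = j} i<m m≤j j<l l≤n = crosses-interleaved⇔sameSide
      (black<black i<m) (black<white m≤j) (white<white j<l) (white≤N l≤n)
      (black-side (ℕ.≤-<-trans z≤n i<m) (ℕ.≤-trans m≤j (ℕ.<⇒≤ j<n))) (white-side j<n)
      where
      j<n : j <ℕ n
      j<n = ℕ.<-≤-trans j<l l≤n

    crosses⇔oppositeSign : ∀ {i j m l} → i <ℕ m → m ≤ℕ l → l <ℕ j → j ≤ℕ n →
      Crosses (black i) (white j) (black m) (white l) ⇔ sign m ≢ sign (suc l)
    crosses⇔oppositeSign {l = l} i<m m≤l l<j j≤n = crosses-nested⇔oppositeSides
      (black<black i<m) (black<white m≤l) (white<white l<j) (white≤N j≤n)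
      (black-side (ℕ.≤-<-trans z≤n i<m) (ℕ.≤-trans m≤l (ℕ.<⇒≤ l<n))) (white-side l<n)
      where
      l<n : l <ℕ n
      l<n = ℕ.<-≤-trans l<j j≤n

    private
      ¬crosses-sharingBlack-< : ∀ {b j l} → b ≤ℕ j → j <ℕ l → l ≤ℕ n →
        ¬ Crosses (black b) (white l) (black b) (white j)
      ¬crosses-sharingBlack-< {b} {j} {l} b≤j j<l l≤n =
        ¬crosses-sharingFirst (sign (suc j)) (black b) (white l) (white j)
          (chord-side (sign (suc j)) (black<white b≤j) (white<white j<l) (white≤N l≤n) (white-side (ℕ.<-≤-trans j<l l≤n)))

    ¬crosses-sharingBlack : ∀ {b j l} → b ≤ℕ j → b ≤ℕ l → j ≢ l → j ≤ℕ n → l ≤ℕ n →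
      ¬ Crosses (black b) (white j) (black b) (white l)
    ¬crosses-sharingBlack {b} {j} {l} b≤j b≤l j≢l j≤n l≤n with ℕ.<-cmp j l
    ... | tri< j<l _ _ = ¬crosses-sharingBlack-< b≤j j<l l≤n ∘ crosses-sym (black b) (white j) (black b) (white l)
    ... | tri≈ _ j≡l _ = ⊥-elim (j≢l j≡l)
    ... | tri> _ _ l<j = ¬crosses-sharingBlack-< b≤l l<j j≤n

    private
      ¬crosses-sharingWhite-< : ∀ {i m j} → i <ℕ m → m ≤ℕ j → j ≤ℕ n →
        ¬ Crosses (black i) (white j) (black m) (white j)
      ¬crosses-sharingWhite-< {i} {m} {j} i<m m≤j j≤n =
        ¬crosses-sharingSecond (sign m) (black i) (white j) (black m)
          (chord-side (sign m) (black<black i<m) (black<white m≤j) (white≤N j≤n)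
            (black-side (ℕ.≤-<-trans z≤n i<m) (ℕ.≤-trans m≤j j≤n)))

    ¬crosses-sharingWhite : ∀ {i m j} → i ≢ m → i ≤ℕ j → m ≤ℕ j → j ≤ℕ n →
      ¬ Crosses (black i) (white j) (black m) (white j)
    ¬crosses-sharingWhite {i} {m} {j} i≢m i≤j m≤j j≤n with ℕ.<-cmp i m
    ... | tri< i<m _ _ = ¬crosses-sharingWhite-< i<m m≤j j≤n
    ... | tri≈ _ i≡m _ = ⊥-elim (i≢m i≡m)
    ... | tri> _ _ m<i = ¬crosses-sharingWhite-< m<i i≤j j≤n ∘ crosses-sym (black i) (white j) (black m) (white j)

    height : ℕ → ℕ → ℚ
    height i j = signed (sign i) (toℚ i) * signed (opposite (sign (suc j))) (toℚ (n ∸ j))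

    X : ℕ → ℕ → ℚ
    X m i = signed (sign m ⊙ sign i) (toℚ i)

    Z-sign : ℕ → ℕ → Sign
    Z-sign m j = sign m ⊙ opposite (sign (suc j))

    Z : ℕ → ℕ → ℚ
    Z m j = signed (Z-sign m j) (toℚ (n ∸ j))

    height≡X*Z : ∀ m i j → height i j ≡ X m i * Z m j
    height≡X*Z m i j = sym (signed-⊙-* (sign m) (sign i) (opposite (sign (suc j))) (toℚ i) (toℚ (n ∸ j)))

    X<X-self : ∀ {m i} → i <ℕ m → X m i < X m m
    X<X-self {m} {i} i<m = subst (λ s → X m i < signed s (toℚ m)) (sym (⊙-self (sign m))) (signed<toℚ (sign m ⊙ sign i) i<m)

    private
      n∸-mono : ∀ {j l} → j <ℕ l → l ≤ℕ n → n ∸ l <ℕ n ∸ j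
      n∸-mono j<l l≤n = ℕ.∸-monoʳ-< j<l l≤n

    Z-injective : ∀ m {j l} → j ≢ l → j ≤ℕ n → l ≤ℕ n → Z m j ≢ Z m l
    Z-injective m {j} {l} j≢l j≤n l≤n with ℕ.<-cmp j l
    ... | tri< j<l _ _ = dominant-≢ (n∸-mono j<l l≤n) (Z-sign m j) (Z-sign m l)
    ... | tri≈ _ j≡l _ = ⊥-elim (j≢l j≡l)
    ... | tri> _ _ l<j = dominant-≢ (n∸-mono l<j j≤n) (Z-sign m l) (Z-sign m j) ∘ sym

    Z<⇔sameSign : ∀ m {j l} → j <ℕ l → l ≤ℕ n → Z m j < Z m l ⇔ sign m ≡ sign (suc j)
    Z<⇔sameSign m {j} {l} j<l l≤n =
      ⊙-opposite≡minus⇔≡ (sign m) (sign (suc j)) ⇔-∘ dominant-<⇔minus (n∸-mono j<l l≤n) (Z-sign m j) (Z-sign m l)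

    Z<⇔oppositeSign : ∀ m {j l} → l <ℕ j → j ≤ℕ n → Z m j < Z m l ⇔ sign m ≢ sign (suc l)
    Z<⇔oppositeSign m {j} {l} l<j j≤n =
      ⊙-opposite≡plus⇔≢ (sign m) (sign (suc l)) ⇔-∘ dominant->⇔plus (n∸-mono l<j j≤n) (Z-sign m l) (Z-sign m j)

    crosses⇔Z< : ∀ {i j m l} → i <ℕ m → i ≤ℕ j → m ≤ℕ l → j ≢ l → j ≤ℕ n → l ≤ℕ n →
      Crosses (black i) (white j) (black m) (white l) ⇔ (m ≤ℕ j × Z m j < Z m l)
    crosses⇔Z< {i} {j} {m} {l} i<m i≤j m≤l j≢l j≤n l≤n = mk⇔ to from
      where
      to : Crosses (black i) (white j) (black m) (white l) → m ≤ℕ j × Z m j < Z m l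
      to cr with m ℕ.≤? j
      ... | no m≰j = ⊥-elim (¬crosses-separatedEdges i≤j (ℕ.≰⇒> m≰j) m≤l l≤n cr)
      ... | yes m≤j with ℕ.<-cmp j l
      ...   | tri< j<l _ _ =
        m≤j , Equivalence.from (Z<⇔sameSign m j<l l≤n) (Equivalence.to (crosses⇔sameSign i<m m≤j j<l l≤n) cr)
      ...   | tri≈ _ j≡l _ = ⊥-elim (j≢l j≡l)
      ...   | tri> _ _ l<j =
        m≤j , Equivalence.from (Z<⇔oppositeSign m l<j j≤n) (Equivalence.to (crosses⇔oppositeSign i<m m≤l l<j j≤n) cr)
      from : m ≤ℕ j × Z m j < Z m l → Crosses (black i) (white j) (black m) (white l)
      from (m≤j , Zj<Zl) with ℕ.<-cmp j l
      ... | tri< j<l _ _ =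
        Equivalence.from (crosses⇔sameSign i<m m≤j j<l l≤n) (Equivalence.to (Z<⇔sameSign m j<l l≤n) Zj<Zl)
      ... | tri≈ _ j≡l _ = ⊥-elim (j≢l j≡l)
      ... | tri> _ _ l<j =
        Equivalence.from (crosses⇔oppositeSign i<m m≤l l<j j≤n) (Equivalence.to (Z<⇔oppositeSign m l<j j≤n) Zj<Zl)

  private variable
    p : Level
    k : ℕ

  does≡true⇔ : ∀ {P : Set p} (P? : Dec P) → does P? ≡ true ⇔ P
  does≡true⇔ (yes P) = mk⇔ (λ _ → P) (λ _ → refl)
  does≡true⇔ (no ¬P) = mk⇔ (λ ()) (λ P → ⊥-elim (¬P P))

  subsetOf : {P : Pred (Fin k) p} → Decidable P → Subset k
  subsetOf P? = tabulate (does ∘ P?)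

  ∈-subsetOf⇔ : {P : Pred (Fin k) p} (P? : Decidable P) {x : Fin k} → x ∈ subsetOf P? ⇔ P x
  ∈-subsetOf⇔ P? {x} = mk⇔
    (λ x∈ → Equivalence.to (does≡true⇔ (P? x)) (trans (sym (lookup∘tabulate (does ∘ P?) x)) ([]=⇒lookup x∈)))
    (λ Px → lookup⇒[]= x _ (trans (lookup∘tabulate (does ∘ P?) x) (Equivalence.from (does≡true⇔ (P? x)) Px)))

  module _ {a ℓ₁ ℓ₂} (O : TotalPreorder a ℓ₁ ℓ₂) where
    open TotalPreorder O using (Carrier; _≲_; total) renaming (refl to ≲-refl; trans to ≲-trans)

    argmax : {P : Pred (Fin k) p} → Decidable P → (f : Fin k → Carrier) → ∃ P →
      ∃[ c ] P c × (∀ w → P w → f w ≲ f c)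
    argmax {k = suc k} P? f (i , Pi) with Fin.any? (P? ∘ suc)
    argmax {k = suc k} P? f (zero , P0) | no none = zero , P0 , λ { zero _ → ≲-refl ; (suc w) Pw → ⊥-elim (none (w , Pw)) }
    argmax {k = suc k} P? f (suc i , Pi) | no none = ⊥-elim (none (i , Pi))
    ... | yes ex with argmax (P? ∘ suc) (f ∘ suc) ex | P? zero
    ...   | c , Pc , max | no ¬P0 = suc c , Pc , λ { zero P0 → ⊥-elim (¬P0 P0) ; (suc w) Pw → max w Pw }
    ...   | c , Pc , max | yes P0 with total (f zero) (f (suc c))
    ...     | inj₁ f0≲fc = suc c , Pc , λ { zero _ → f0≲fc ; (suc w) Pw → max w Pw }
    ...     | inj₂ fc≲f0 = zero , P0 , λ { zero _ → ≲-refl ; (suc w) Pw → ≲-trans (max w Pw) fc≲f0 }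

  edgesOf : ∀ {n} {R : Fin (suc n) → Fin (suc n) → Set p} → (∀ b w → Dec (R b w)) → EdgeSet n
  edgesOf R? b w = does (R? b w)

  tree-insert : ∀ pt {n} {I J : Subset (suc n)} {T : EdgeSet n} → IsTree pt I J T → ∀ {b w} → Edge I J b w →
    (∀ b′ w′ → T b′ w′ ≡ true → (b′ , w′) ≢ (b , w) →
       ¬ Crosses (blackPt pt b′) (whitePt pt w′) (blackPt pt b) (whitePt pt w)) →
    T b w ≡ true
  tree-insert pt {n} {I} {J} {T} (inG , nonCrossing , maximal) {b} {w} bw free =
    maximal T⁺ inG⁺ nonCrossing⁺ (λ b′ w′ → from ∘ inj₁) b w (from (inj₂ (refl , refl)))
    where
    T⁺? : ∀ b′ w′ → Dec (T b′ w′ ≡ true ⊎ (b′ ≡ b × w′ ≡ w))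
    T⁺? b′ w′ = (T b′ w′ Bool.≟ true) ⊎-dec ((b′ Fin.≟ b) ×-dec (w′ Fin.≟ w))
    T⁺ : EdgeSet n
    T⁺ = edgesOf T⁺?
    to : ∀ {b′ w′} → T⁺ b′ w′ ≡ true → T b′ w′ ≡ true ⊎ (b′ ≡ b × w′ ≡ w)
    to {b′} {w′} = Equivalence.to (does≡true⇔ (T⁺? b′ w′))
    from : ∀ {b′ w′} → T b′ w′ ≡ true ⊎ (b′ ≡ b × w′ ≡ w) → T⁺ b′ w′ ≡ true
    from {b′} {w′} = Equivalence.from (does≡true⇔ (T⁺? b′ w′))
    inG⁺ : InG I J T⁺
    inG⁺ b′ w′ e with to e
    ... | inj₁ old = inG b′ w′ old
    ... | inj₂ (refl , refl) = bw
    nonCrossing⁺ : NonCrossing pt T⁺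
    nonCrossing⁺ b₁ w₁ b₂ w₂ e₁ e₂ ne with to e₁ | to e₂
    ... | inj₁ old₁ | inj₁ old₂ = nonCrossing b₁ w₁ b₂ w₂ old₁ old₂ ne
    ... | inj₁ old₁ | inj₂ (refl , refl) = free b₁ w₁ old₁ ne
    ... | inj₂ (refl , refl) | inj₁ old₂ =
      free b₂ w₂ old₂ (ne ∘ sym) ∘ crosses-sym (blackPt pt b) (whitePt pt w) (blackPt pt b₂) (whitePt pt w₂)
    ... | inj₂ (refl , refl) | inj₂ (refl , refl) = ⊥-elim (ne refl)

  NoIsolatedWhite : ∀ {n} → Subset (suc n) → Subset (suc n) → Set
  NoIsolatedWhite I J = ∀ w → w ∈ J → ∃[ b ] Edge I J b w

  NoIsolatedBlack : ∀ {n} → Subset (suc n) → Subset (suc n) → Set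
  NoIsolatedBlack I J = ∀ b → b ∈ I → ∃[ w ] Edge I J b w

  Covers : ∀ {n} → Subset (suc n) → EdgeSet n → Set
  Covers J T = ∀ w → w ∈ J → ∃[ b ] T b w ≡ true

  Supports : ∀ {n} → (Fin (suc n) → Fin (suc n) → ℚ) → Subset (suc n) → Subset (suc n) → EdgeSet n →
    (Fin (suc n) → ℚ) → (Fin (suc n) → ℚ) → Set
  Supports h I J T α β = ∀ b w → Edge I J b w →
    (T b w ≡ true → α b + β w ≡ h b w) × (T b w ≡ false → α b + β w < h b w)

  supported-≤ : ∀ {n h I J} {T : EdgeSet n} {α β} → Supports h I J T α β →
    ∀ {b w} → Edge I J b w → α b + β w ≤ h b w
  supported-≤ {T = T} supports {b} {w} e with T b w in eq
  ... | true  = ≤-reflexive (proj₁ (supports b w e) eq)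
  ... | false = <⇒≤ (proj₂ (supports b w e) eq)

  Certified : ∀ {n} → (Fin (suc n) → Fin (suc n) → ℚ) → Subset (suc n) → Subset (suc n) → EdgeSet n → Set
  Certified h I J T = ∃₂ λ α β → Supports h I J T α β × Covers J T

  -- Peeling off the rightmost black vertex

  module Regular {n ε pt} (polygon : IsPolygon n ε pt) where
    open ConvexPolygon polygon

    private
      F : Set
      F = Fin (suc n)
      bp wp : F → Point
      bp = blackPt pt
      wp = whitePt pt
      index≤n : (v : F) → toℕ v ≤ℕ n
      index≤n = Fin.toℕ≤pred[n]
      toℕ-≢ : ∀ {u v : F} → u ≢ v → toℕ u ≢ toℕ v
      toℕ-≢ u≢v = u≢v ∘ Fin.toℕ-injective

    h : F → F → ℚ
    h b w = height (toℕ b) (toℕ w)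

    module Peel (I J : Subset (suc n)) (T : EdgeSet n) (tree : IsTree pt I J T)
                {m : F} (m∈I : m ∈ I) (m-max : ∀ b → b ∈ I → toℕ b ≤ℕ toℕ m) where

      private
        nonCrossing : NonCrossing pt T
        nonCrossing = proj₁ (proj₂ tree)
        T⇒∈I : ∀ {b w} → T b w ≡ true → b ∈ I
        T⇒∈I {b} {w} e = proj₁ (proj₁ tree b w e)
        T⇒∈J : ∀ {b w} → T b w ≡ true → w ∈ J
        T⇒∈J {b} {w} e = proj₁ (proj₂ (proj₁ tree b w e))
        T⇒≤ : ∀ {b w} → T b w ≡ true → toℕ b ≤ℕ toℕ w
        T⇒≤ {b} {w} e = ℕ.≤-pred (proj₂ (proj₂ (proj₁ tree b w e)))
        <m : ∀ {b} → b ∈ I → b ≢ m → toℕ b <ℕ toℕ m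
        <m {b} b∈I b≢m = ℕ.≤∧≢⇒< (m-max b b∈I) (toℕ-≢ b≢m)

      Xₘ Zₘ : F → ℚ
      Xₘ b = X (toℕ m) (toℕ b)
      Zₘ w = Z (toℕ m) (toℕ w)

      h≡Xₘ*Zₘ : ∀ b w → h b w ≡ Xₘ b * Zₘ w
      h≡Xₘ*Zₘ b w = height≡X*Z (toℕ m) (toℕ b) (toℕ w)

      crossing-with-m : ∀ {b v w} → b ∈ I → toℕ b ≤ℕ toℕ v → toℕ m ≤ℕ toℕ w → (b , v) ≢ (m , w) →
        Crosses (bp b) (wp v) (bp m) (wp w) → b ≢ m × toℕ m ≤ℕ toℕ v × Zₘ v < Zₘ w
      crossing-with-m {b} {v} {w} b∈I b≤v m≤w bv≢mw cr with b Fin.≟ m | v Fin.≟ w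
      ... | yes refl | _ =
        ⊥-elim (¬crosses-sharingBlack b≤v m≤w (toℕ-≢ (bv≢mw ∘ cong (m ,_))) (index≤n v) (index≤n w) cr)
      ... | no b≢m | yes refl = ⊥-elim (¬crosses-sharingWhite (toℕ-≢ b≢m) b≤v m≤w (index≤n v) cr)
      ... | no b≢m | no v≢w =
        b≢m , Equivalence.to (crosses⇔Z< (<m b∈I b≢m) b≤v m≤w (toℕ-≢ v≢w) (index≤n v) (index≤n w)) cr

      m-adjacent : ∀ {w} → w ∈ J → toℕ m ≤ℕ toℕ w →
        (∀ {b v} → T b v ≡ true → b ≢ m → toℕ m ≤ℕ toℕ v → ¬ Zₘ v < Zₘ w) → T m w ≡ true
      m-adjacent {w} w∈J m≤w unblocked = tree-insert pt tree (m∈I , w∈J , s≤s m≤w) free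
        where
        free : ∀ b v → T b v ≡ true → (b , v) ≢ (m , w) → ¬ Crosses (bp b) (wp v) (bp m) (wp w)
        free b v Tbv bv≢mw cr with crossing-with-m (T⇒∈I Tbv) (T⇒≤ Tbv) m≤w bv≢mw cr
        ... | b≢m , m≤v , Zv<Zw = unblocked Tbv b≢m m≤v Zv<Zw

      m-has-edge : NoIsolatedBlack I J → ∃[ w ] T m w ≡ true
      m-has-edge noIsolated with noIsolated m m∈I
      ... | w , _ , w∈J , m<1+w with argmax (Flip.totalPreorder ≤-totalPreorder)
                                      (λ v → (v ∈? J) ×-dec (toℕ m ℕ.≤? toℕ v)) Zₘ (w , w∈J , ℕ.≤-pred m<1+w)
      ...   | w₀ , (w₀∈J , m≤w₀) , minimal = w₀ , m-adjacent w₀∈J m≤w₀ unblocked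
        where
        unblocked : ∀ {b v} → T b v ≡ true → b ≢ m → toℕ m ≤ℕ toℕ v → ¬ Zₘ v < Zₘ w₀
        unblocked {v = v} Tbv _ m≤v Zv<Zw₀ = <-irrefl refl (<-≤-trans Zv<Zw₀ (minimal v (T⇒∈J Tbv , m≤v)))

      single : (∀ b → b ∈ I → b ≡ m) → NoIsolatedWhite I J → Certified h I J T
      single only-m noIsolated = (λ _ → 0ℚ) , h m , supports , covers
        where
        adjacent : ∀ {w} → w ∈ J → toℕ m ≤ℕ toℕ w → T m w ≡ true
        adjacent w∈J m≤w = m-adjacent w∈J m≤w (λ Tbv b≢m → ⊥-elim (b≢m (only-m _ (T⇒∈I Tbv))))
        supports : Supports h I J T (λ _ → 0ℚ) (h m)
        supports b w (b∈I , w∈J , b<1+w) with only-m b b∈I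
        ... | refl = (λ _ → +-identityˡ (h m w)) ,
                     (λ T-mw≡false → ⊥-elim (Bool.not-¬ T-mw≡false (adjacent w∈J (ℕ.≤-pred b<1+w))))
        covers : Covers J T
        covers w w∈J with noIsolated w w∈J
        ... | b , b∈I , _ , b<1+w with only-m b b∈I
        ...   | refl = m , adjacent w∈J (ℕ.≤-pred b<1+w)

      module Leaves (c : F) (T-mc : T m c ≡ true) (c-max : ∀ w → T m w ≡ true → Zₘ w ≤ Zₘ c) where

        Leaf : F → Set
        Leaf w = T m w ≡ true × w ≢ c

        leaf? : Decidable Leaf
        leaf? w = (T m w Bool.≟ true) ×-dec ¬? (w Fin.≟ c)

        ¬T-below-c : ∀ {b w} → T b w ≡ true → b ≢ m → toℕ m ≤ℕ toℕ w → w ≢ c → ¬ Zₘ w < Zₘ c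
        ¬T-below-c {b} {w} Tbw b≢m m≤w w≢c Zw<Zc = nonCrossing b w m c Tbw T-mc (b≢m ∘ cong proj₁)
          (Equivalence.from (crosses⇔Z< (<m (T⇒∈I Tbw) b≢m) (T⇒≤ Tbw) (T⇒≤ T-mc) (toℕ-≢ w≢c)
                                        (index≤n w) (index≤n c))
            (m≤w , Zw<Zc))

        below-c-adjacent : ∀ {w} → w ∈ J → toℕ m ≤ℕ toℕ w → Zₘ w ≤ Zₘ c → T m w ≡ true
        below-c-adjacent {w} w∈J m≤w Zw≤Zc = m-adjacent w∈J m≤w unblocked
          where
          unblocked : ∀ {b v} → T b v ≡ true → b ≢ m → toℕ m ≤ℕ toℕ v → ¬ Zₘ v < Zₘ w
          unblocked {v = v} Tbv b≢m m≤v Zv<Zw with v Fin.≟ c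
          ... | yes refl = <-irrefl refl (<-≤-trans Zv<Zw Zw≤Zc)
          ... | no v≢c = ¬T-below-c Tbv b≢m m≤v v≢c (<-≤-trans Zv<Zw Zw≤Zc)

        leaf-Z< : ∀ {w} → Leaf w → Zₘ w < Zₘ c
        leaf-Z< {w} (T-mw , w≢c) = ≤∧≢⇒< (c-max w T-mw) (Z-injective (toℕ m) (toℕ-≢ w≢c) (index≤n w) (index≤n c))

        leaf-pendant : ∀ {b w} → T b w ≡ true → b ≢ m → ¬ Leaf w
        leaf-pendant Tbw b≢m leaf@(T-mw , w≢c) = ¬T-below-c Tbw b≢m (T⇒≤ T-mw) w≢c (leaf-Z< leaf)

        I′ J′ : Subset (suc n)
        I′ = subsetOf (λ b → (b ∈? I) ×-dec ¬? (b Fin.≟ m))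
        J′ = subsetOf (λ w → (w ∈? J) ×-dec ¬? (leaf? w))

        T′ : EdgeSet n
        T′ = edgesOf (λ b w → (T b w Bool.≟ true) ×-dec ¬? (b Fin.≟ m))

        ∈I′⇔ : ∀ {b} → b ∈ I′ ⇔ (b ∈ I × b ≢ m)
        ∈I′⇔ = ∈-subsetOf⇔ (λ b → (b ∈? I) ×-dec ¬? (b Fin.≟ m))

        ∈J′⇔ : ∀ {w} → w ∈ J′ ⇔ (w ∈ J × ¬ Leaf w)
        ∈J′⇔ = ∈-subsetOf⇔ (λ w → (w ∈? J) ×-dec ¬? (leaf? w))

        T′⇔ : ∀ {b w} → T′ b w ≡ true ⇔ (T b w ≡ true × b ≢ m)
        T′⇔ {b} {w} = does≡true⇔ ((T b w Bool.≟ true) ×-dec ¬? (b Fin.≟ m))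

        c∈J′ : c ∈ J′
        c∈J′ = Equivalence.from ∈J′⇔ (T⇒∈J T-mc , λ leaf → proj₂ leaf refl)

        I′<m : ∀ b → b ∈ I′ → toℕ b <ℕ toℕ m
        I′<m b b∈I′ = <m (proj₁ (Equivalence.to ∈I′⇔ b∈I′)) (proj₂ (Equivalence.to ∈I′⇔ b∈I′))

        noIsolatedBlack′ : NoIsolatedBlack I′ J′
        noIsolatedBlack′ b b∈I′ = c , b∈I′ , c∈J′ , ℕ.<-≤-trans (I′<m b b∈I′) (ℕ.m≤n⇒m≤1+n (T⇒≤ T-mc))

        noIsolatedWhite′ : ∀ {b₀} → b₀ ∈ I → b₀ ≢ m → NoIsolatedWhite I J → NoIsolatedWhite I′ J′
        noIsolatedWhite′ {b₀} b₀∈I b₀≢m noIsolated w w∈J′ with noIsolated w (proj₁ (Equivalence.to ∈J′⇔ w∈J′))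
        ... | b , b∈I , _ , b<1+w with b Fin.≟ m
        ...   | no b≢m = b , Equivalence.from ∈I′⇔ (b∈I , b≢m) , w∈J′ , b<1+w
        ...   | yes refl = b₀ , b₀∈I′ , w∈J′ , ℕ.<-trans (I′<m b₀ b₀∈I′) b<1+w
          where
          b₀∈I′ : b₀ ∈ I′
          b₀∈I′ = Equivalence.from ∈I′⇔ (b₀∈I , b₀≢m)

        private
          mixed-¬crosses : ∀ {T″ b v w} → InG I′ J′ T″ → T″ b v ≡ true → T m w ≡ true →
            ¬ Crosses (bp b) (wp v) (bp m) (wp w)
          mixed-¬crosses {b = b} {v} {w} inG″ T″bv T-mw cr
            with inG″ b v T″bv
          ... | b∈I′ , v∈J′ , b<1+v
            with Equivalence.to ∈I′⇔ b∈I′ | Equivalence.to ∈J′⇔ v∈J′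
          ... | b∈I , b≢m | v∈J , ¬leaf
            with crossing-with-m b∈I (ℕ.≤-pred b<1+v) (T⇒≤ T-mw) (b≢m ∘ cong proj₁) cr
          ... | _ , m≤v , Zv<Zw with v Fin.≟ c
          ...   | yes refl = <-irrefl refl (<-≤-trans Zv<Zw (c-max w T-mw))
          ...   | no v≢c = ¬leaf (below-c-adjacent v∈J m≤v (<⇒≤ (<-≤-trans Zv<Zw (c-max w T-mw))) , v≢c)

        maximal′ : ∀ T″ → InG I′ J′ T″ → NonCrossing pt T″ → (∀ b w → T′ b w ≡ true → T″ b w ≡ true) →
          ∀ b w → T″ b w ≡ true → T′ b w ≡ true
        maximal′ T″ inG″ nonCrossing″ T′⊆T″ b w T″bw =
          Equivalence.from T′⇔ (T*⊆T b w (from* {b} {w} (inj₂ (b≢m , T″bw))) , b≢m)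
          where
          b≢m : b ≢ m
          b≢m = proj₂ (Equivalence.to ∈I′⇔ (proj₁ (inG″ b w T″bw)))
          T*? : ∀ b w → Dec ((b ≡ m × T b w ≡ true) ⊎ (b ≢ m × T″ b w ≡ true))
          T*? b w = ((b Fin.≟ m) ×-dec (T b w Bool.≟ true)) ⊎-dec (¬? (b Fin.≟ m) ×-dec (T″ b w Bool.≟ true))
          T* : EdgeSet n
          T* = edgesOf T*?
          to* : ∀ {b w} → T* b w ≡ true → (b ≡ m × T b w ≡ true) ⊎ (b ≢ m × T″ b w ≡ true)
          to* {b} {w} = Equivalence.to (does≡true⇔ (T*? b w))
          from* : ∀ {b w} → (b ≡ m × T b w ≡ true) ⊎ (b ≢ m × T″ b w ≡ true) → T* b w ≡ true
          from* {b} {w} = Equivalence.from (does≡true⇔ (T*? b w))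
          inG* : InG I J T*
          inG* b w e with to* e
          ... | inj₁ (_ , Tbw) = proj₁ tree b w Tbw
          ... | inj₂ (_ , T″bw) with inG″ b w T″bw
          ...   | b∈I′ , w∈J′ , b<1+w =
            proj₁ (Equivalence.to ∈I′⇔ b∈I′) , proj₁ (Equivalence.to ∈J′⇔ w∈J′) , b<1+w
          nonCrossing* : NonCrossing pt T*
          nonCrossing* b₁ w₁ b₂ w₂ e₁ e₂ ne with to* e₁ | to* e₂
          ... | inj₁ (_ , T₁) | inj₁ (_ , T₂) = nonCrossing b₁ w₁ b₂ w₂ T₁ T₂ ne
          ... | inj₂ (_ , T″₁) | inj₂ (_ , T″₂) = nonCrossing″ b₁ w₁ b₂ w₂ T″₁ T″₂ ne
          ... | inj₂ (_ , T″₁) | inj₁ (refl , T₂) = mixed-¬crosses inG″ T″₁ T₂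
          ... | inj₁ (refl , T₁) | inj₂ (_ , T″₂) =
            mixed-¬crosses inG″ T″₂ T₁ ∘ crosses-sym (bp m) (wp w₁) (bp b₂) (wp w₂)
          T⊆T* : ∀ b w → T b w ≡ true → T* b w ≡ true
          T⊆T* b w Tbw = from* {b} {w} (split (b Fin.≟ m))
            where
            split : Dec (b ≡ m) → (b ≡ m × T b w ≡ true) ⊎ (b ≢ m × T″ b w ≡ true)
            split (yes b≡m) = inj₁ (b≡m , Tbw)
            split (no b≢m) = inj₂ (b≢m , T′⊆T″ b w (Equivalence.from T′⇔ (Tbw , b≢m)))
          T*⊆T : ∀ b w → T* b w ≡ true → T b w ≡ true
          T*⊆T = proj₂ (proj₂ tree) T* inG* nonCrossing* T⊆T*

        tree′ : IsTree pt I′ J′ T′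
        tree′ = inG′ , nonCrossing′ , maximal′
          where
          inG′ : InG I′ J′ T′
          inG′ b w T′bw with Equivalence.to T′⇔ T′bw
          ... | Tbw , b≢m = Equivalence.from ∈I′⇔ (T⇒∈I Tbw , b≢m) ,
                            Equivalence.from ∈J′⇔ (T⇒∈J Tbw , leaf-pendant Tbw b≢m) , s≤s (T⇒≤ Tbw)
          nonCrossing′ : NonCrossing pt T′
          nonCrossing′ b w b′ w′ e e′ =
            nonCrossing b w b′ w′ (proj₁ (Equivalence.to T′⇔ e)) (proj₁ (Equivalence.to T′⇔ e′))

        module Extend (α′ β′ : F → ℚ) (supports′ : Supports h I′ J′ T′ α′ β′) (covers′ : Covers J′ T′) where

          i₁ : F
          i₁ = proj₁ (covers′ c c∈J′)

          T′-i₁c : T′ i₁ c ≡ true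
          T′-i₁c = proj₂ (covers′ c c∈J′)

          i₁∈I′ : i₁ ∈ I′
          i₁∈I′ = proj₁ (proj₁ tree′ i₁ c T′-i₁c)

          αₘ : ℚ
          αₘ = h m c - β′ c

          α : F → ℚ
          α b = if does (b Fin.≟ m) then αₘ else α′ b

          β : F → ℚ
          β w = if does (leaf? w) then h m w - αₘ else β′ w

          α-m : α m ≡ αₘ
          α-m = cong (if_then αₘ else α′ m) (dec-true (m Fin.≟ m) refl)

          α-other : ∀ {b} → b ≢ m → α b ≡ α′ b
          α-other {b} b≢m = cong (if_then αₘ else α′ b) (dec-false (b Fin.≟ m) b≢m)

          β-leaf : ∀ {w} → Leaf w → β w ≡ h m w - αₘ
          β-leaf {w} leaf = cong (if_then h m w - αₘ else β′ w) (dec-true (leaf? w) leaf)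

          β-other : ∀ {w} → ¬ Leaf w → β w ≡ β′ w
          β-other {w} ¬leaf = cong (if_then h m w - αₘ else β′ w) (dec-false (leaf? w) ¬leaf)

          tight-at-m : ∀ {w} → T m w ≡ true → α m + β w ≡ h m w
          tight-at-m {w} T-mw = split (w Fin.≟ c)
            where
            split : Dec (w ≡ c) → α m + β w ≡ h m w
            split (yes refl) = begin
              α m + β c       ≡⟨ cong₂ _+_ α-m (β-other (λ leaf → proj₂ leaf refl)) ⟩
              αₘ + β′ c       ≡⟨ solve 2 (λ p q → (p :- q) :+ q := p) refl (h m c) (β′ c) ⟩
              h m c           ∎
              where open ≡-Reasoning
            split (no w≢c) = begin
              α m + β w       ≡⟨ cong₂ _+_ α-m (β-leaf (T-mw , w≢c)) ⟩
              αₘ + (h m w - αₘ) ≡⟨ solve 2 (λ p q → p :+ (q :- p) := q) refl αₘ (h m w) ⟩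
              h m w           ∎
              where open ≡-Reasoning

          below-at-m : ∀ {w} → w ∈ J → toℕ m ≤ℕ toℕ w → T m w ≡ false → α m + β w < h m w
          below-at-m {w} w∈J m≤w T-mw≡false = subst₂ _<_ (sym value) (sym (h≡Xₘ*Zₘ m w))
            (new-row-strictly-below {a = α′ i₁} tight′ below′ (X<X-self (I′<m _ i₁∈I′)) Zc<Zw)
            where
            ¬leaf : ¬ Leaf w
            ¬leaf (T-mw , _) = Bool.not-¬ T-mw≡false T-mw
            w∈J′ : w ∈ J′
            w∈J′ = Equivalence.from ∈J′⇔ (w∈J , ¬leaf)
            Zc<Zw : Zₘ c < Zₘ w
            Zc<Zw = ≰⇒> (Bool.not-¬ T-mw≡false ∘ below-c-adjacent w∈J m≤w)
            tight′ : α′ i₁ + β′ c ≡ Xₘ i₁ * Zₘ c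
            tight′ = trans (proj₁ (supports′ i₁ c (proj₁ tree′ i₁ c T′-i₁c)) T′-i₁c) (h≡Xₘ*Zₘ i₁ c)
            below′ : α′ i₁ + β′ w ≤ Xₘ i₁ * Zₘ w
            below′ = subst (α′ i₁ + β′ w ≤_) (h≡Xₘ*Zₘ i₁ w)
              (supported-≤ {α = α′} {β = β′} supports′
                (i₁∈I′ , w∈J′ , ℕ.<-≤-trans (I′<m _ i₁∈I′) (ℕ.m≤n⇒m≤1+n m≤w)))
            value : α m + β w ≡ (Xₘ m * Zₘ c - β′ c) + β′ w
            value = cong₂ _+_ (trans α-m (cong (_- β′ c) (h≡Xₘ*Zₘ m c))) (β-other ¬leaf)

          tight-off-m : ∀ {b w} → T b w ≡ true → b ≢ m → α b + β w ≡ h b w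
          tight-off-m {b} {w} Tbw b≢m = begin
            α b + β w     ≡⟨ cong₂ _+_ (α-other b≢m) (β-other (leaf-pendant Tbw b≢m)) ⟩
            α′ b + β′ w   ≡⟨ proj₁ (supports′ b w (proj₁ tree′ b w T′bw)) T′bw ⟩
            h b w         ∎
            where
            open ≡-Reasoning
            T′bw : T′ b w ≡ true
            T′bw = Equivalence.from T′⇔ (Tbw , b≢m)

          below-off-m : ∀ {b w} → Edge I J b w → b ≢ m → T b w ≡ false → α b + β w < h b w
          below-off-m {b} {w} (b∈I , w∈J , b<1+w) b≢m Tbw≡false = split (leaf? w)
            where
            b∈I′ : b ∈ I′
            b∈I′ = Equivalence.from ∈I′⇔ (b∈I , b≢m)
            split : Dec (Leaf w) → α b + β w < h b w
            split (yes leaf) = subst₂ _<_ (sym value) (sym (h≡Xₘ*Zₘ b w))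
              (new-column-strictly-below {a = α′ b} {b = β′ c} below′ (X<X-self (I′<m _ b∈I′)) (leaf-Z< leaf))
              where
              below′ : α′ b + β′ c ≤ Xₘ b * Zₘ c
              below′ = subst (α′ b + β′ c ≤_) (h≡Xₘ*Zₘ b c)
                (supported-≤ {α = α′} {β = β′} supports′
                  (b∈I′ , c∈J′ , ℕ.<-≤-trans (I′<m _ b∈I′) (ℕ.m≤n⇒m≤1+n (T⇒≤ T-mc))))
              value : α b + β w ≡ α′ b + (Xₘ m * Zₘ w - (Xₘ m * Zₘ c - β′ c))
              value = cong₂ _+_ (α-other b≢m)
                (trans (β-leaf leaf) (cong₂ (λ p q → p - (q - β′ c)) (h≡Xₘ*Zₘ m w) (h≡Xₘ*Zₘ m c)))
            split (no ¬leaf) = subst (_< h b w) (sym (cong₂ _+_ (α-other b≢m) (β-other ¬leaf)))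
              (proj₂ (supports′ b w (b∈I′ , Equivalence.from ∈J′⇔ (w∈J , ¬leaf) , b<1+w)) T′bw≡false)
              where
              T′bw≡false : T′ b w ≡ false
              T′bw≡false = Bool.¬-not (Bool.not-¬ Tbw≡false ∘ proj₁ ∘ Equivalence.to T′⇔)

          supports : Supports h I J T α β
          supports b w e@(b∈I , w∈J , b<1+w) = split (b Fin.≟ m)
            where
            split : Dec (b ≡ m) → (T b w ≡ true → α b + β w ≡ h b w) × (T b w ≡ false → α b + β w < h b w)
            split (yes refl) = tight-at-m , below-at-m w∈J (ℕ.≤-pred b<1+w)
            split (no b≢m) = (λ Tbw → tight-off-m Tbw b≢m) , below-off-m e b≢m

          covers : Covers J T
          covers w w∈J = split (T m w Bool.≟ true)
            where
            split : Dec (T m w ≡ true) → ∃[ b ] T b w ≡ true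
            split (yes T-mw) = m , T-mw
            split (no ¬T-mw) with covers′ w (Equivalence.from ∈J′⇔ (w∈J , ¬T-mw ∘ proj₁))
            ... | b , T′bw = b , proj₁ (Equivalence.to T′⇔ T′bw)

          extended : Certified h I J T
          extended = α , β , supports , covers

        extend : Certified h I′ J′ T′ → Certified h I J T
        extend (α′ , β′ , supports′ , covers′) = Extend.extended α′ β′ supports′ covers′

      peel : ∀ {b₀} → b₀ ∈ I → b₀ ≢ m → NoIsolatedWhite I J → NoIsolatedBlack I J →
        (∀ {I′ J′ T′} → (∀ b → b ∈ I′ → toℕ b <ℕ toℕ m) → Nonempty I′ →
           NoIsolatedWhite I′ J′ → NoIsolatedBlack I′ J′ → IsTree pt I′ J′ T′ → Certified h I′ J′ T′) →
        Certified h I J T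
      peel b₀∈I b₀≢m noIsolatedW noIsolatedB recurse with m-has-edge noIsolatedB
      ... | w₀ , T-mw₀ with argmax ≤-totalPreorder (λ w → T m w Bool.≟ true) Zₘ (w₀ , T-mw₀)
      ...   | c , T-mc , c-max = extend (recurse I′<m (_ , Equivalence.from ∈I′⇔ (b₀∈I , b₀≢m))
                                   (noIsolatedWhite′ b₀∈I b₀≢m noIsolatedW) noIsolatedBlack′ tree′)
        where open Leaves c T-mc c-max

    certified : ∀ k {I J T} → (∀ b → b ∈ I → toℕ b <ℕ k) → Nonempty I →
      NoIsolatedWhite I J → NoIsolatedBlack I J → IsTree pt I J T → Certified h I J T
    certified zero bound (b , b∈I) = ⊥-elim (ℕ.n≮0 (bound b b∈I))
    certified (suc k) {I} {J} {T} bound nonempty noIsolatedW noIsolatedB tree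
      with argmax ℕ.≤-totalPreorder (_∈? I) toℕ nonempty
    ... | m , m∈I , m-max with Fin.any? (λ b → (b ∈? I) ×-dec ¬? (b Fin.≟ m))
    ...   | no none = Peel.single I J T tree m∈I m-max
                        (λ b b∈I → decidable-stable (b Fin.≟ m) (λ b≢m → none (b , b∈I , b≢m))) noIsolatedW
    ...   | yes (_ , b₀∈I , b₀≢m) = Peel.peel I J T tree m∈I m-max b₀∈I b₀≢m noIsolatedW noIsolatedB
      (λ bound′ → certified k (λ b b∈I′ → ℕ.<-≤-trans (bound′ b b∈I′) (ℕ.≤-pred (bound m m∈I))))

  module _ {n} {I J : Subset (suc n)} (nonemptyI : Nonempty I) (nonemptyJ : Nonempty J) where

    noIsolatedWhite : MinLt I J → NoIsolatedWhite I J
    noIsolatedWhite minLt w w∈J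
      with argmax (Flip.totalPreorder ℕ.≤-totalPreorder) (_∈? I) toℕ nonemptyI
         | argmax (Flip.totalPreorder ℕ.≤-totalPreorder) (_∈? J) toℕ nonemptyJ
    ... | b , b∈I , b-min | w₀ , w₀∈J , w₀-min =
      b , b∈I , w∈J , ℕ.<-≤-trans (minLt b w₀ (b∈I , b-min) (w₀∈J , w₀-min)) (s≤s (w₀-min w w∈J))

    noIsolatedBlack : MaxLt I J → NoIsolatedBlack I J
    noIsolatedBlack maxLt b b∈I
      with argmax ℕ.≤-totalPreorder (_∈? I) toℕ nonemptyI
         | argmax ℕ.≤-totalPreorder (_∈? J) toℕ nonemptyJ
    ... | b₁ , b₁∈I , b₁-max | w , w∈J , w-max =
      w , b∈I , w∈J , ℕ.≤-<-trans (b₁-max b b∈I) (maxLt b₁ w (b₁∈I , b₁-max) (w∈J , w-max))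

open import Defs
open import Data.Nat using (ℕ; suc; _≤_)
open import Data.Fin using (Fin)
open import Data.Fin.Subset using (Subset; Nonempty)
open import Data.Fin.Properties using (toℕ<n)
open import Data.Product using (_,_)
open TreeTriangulations using (module Regular; noIsolatedWhite; noIsolatedBlack)

proposition3p8 : (n : ℕ) → 1 ≤ n → (ε : Fin n → Sign) → (pt : ℕ → Point) →
    IsPolygon n ε pt →
    (I J : Subset (suc n)) → Nonempty I → Nonempty J →
    MinLt I J → MaxLt I J →
    IsRegularTreeTriangulation pt I J
proposition3p8 n _ ε pt polygon I J nonemptyI nonemptyJ minLt maxLt = h , λ T tree →
  let α , β , supports , _ = certified (suc n) (λ b _ → toℕ<n b) nonemptyI
                               (noIsolatedWhite nonemptyI nonemptyJ minLt) (noIsolatedBlack nonemptyI nonemptyJ maxLt) tree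
  in α , β , supports
  where open Regular polygon using (h; certified)
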